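{- Let $G=(V,E)$ be a finite simple graph and let $a,b$ be distinct non-isolated vertices of $G$. Then $a$ dominates $b$ in ${\rm Dom}(G)$ if and only if for every $v\in N[b]\setminus N[a]$ there exists $m\in V$ such that $N[m]\setminus\{a\}\subset N[v]\setminus\{b\}$.
   Context: For $v\in V$, $N[v]$ is the closed neighborhood of $v$ ($v$ together with its neighbors). A set $D\subset V$ is dominating if every vertex lies in $D$ or is adjacent to a vertex of $D$. ${\rm Dom}(G)$ is the dominance complex: the simplicial complex on $V$ whose faces are the complements $V\setminus D$ of dominating sets $D$. For a simplicial complex $\Delta$ on a finite set $X$ and $a\in X$: $(\Delta:a)=\{m\in\Delta: a\notin m,\ m\cup\{a\}\in\Delta\}$ and $(\Delta,a)=\{m\in\Delta: a\notin m\}$. A simplicial complex $C$ is a cone with apex $b$ if $\sigma\cup\{b\}\in C$ for every $\sigma\in C$. $a$ dominates $b$ in $\Delta$ if there is a cone $C$ with apex $b$ with $(\Delta:a)\subseteq C\subseteq(\Delta,a)$. -}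

module Defs where

open import Level using (0ℓ)
open import Data.Nat using (ℕ)
open import Data.Fin using (Fin)
open import Data.Fin.Subset using (Subset; _∈_; _∉_; _⊆_; _∪_; ⁅_⁆; ∁)
open import Data.Product using (Σ; ∃; _×_; _,_)
open import Data.Sum using (_⊎_)
open import Relation.Nullary using (¬_; Dec)
open import Relation.Binary.PropositionalEquality using (_≡_; _≢_)

record Graph (n : ℕ) : Set₁ where
  field
    Adj       : Fin n → Fin n → Set
    Adj-sym   : ∀ {u v} → Adj u v → Adj v u
    Adj-irrefl : ∀ {u} → ¬ Adj u u
    Adj-dec   : ∀ u v → Dec (Adj u v)
open Graph public

module _ {n : ℕ} (G : Graph n) where

  InN : Fin n → Fin n → Set
  InN u v = u ≡ v ⊎ Adj G u v

  Isolated : Fin n → Set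
  Isolated v = ∀ u → ¬ Adj G v u

  Dominating : Subset n → Set
  Dominating D = ∀ u → ∃ λ d → d ∈ D × InN u d

SetFamily : ℕ → Set₁
SetFamily n = Subset n → Set

IsComplex : {n : ℕ} → SetFamily n → Set
IsComplex {n} Δ = ∀ (σ τ : Subset n) → τ ⊆ σ → Δ σ → Δ τ

Dom : {n : ℕ} → Graph n → SetFamily n
Dom G σ = Dominating G (∁ σ)

Link : {n : ℕ} → SetFamily n → Fin n → SetFamily n
Link Δ a m = Δ m × a ∉ m × Δ (m ∪ ⁅ a ⁆)

Deletion : {n : ℕ} → SetFamily n → Fin n → SetFamily n
Deletion Δ a m = Δ m × a ∉ m

IsConeWithApex : {n : ℕ} → SetFamily n → Fin n → Set
IsConeWithApex {n} C b = ∀ (σ : Subset n) → C σ → C (σ ∪ ⁅ b ⁆)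

DominatesIn : {n : ℕ} → SetFamily n → Fin n → Fin n → Set₁
DominatesIn {n} Δ a b =
  Σ (SetFamily n) λ C →
    IsComplex C × IsConeWithApex C b
    × (∀ m → Link Δ a m → C m)
    × (∀ m → C m → Deletion Δ a m)

-- The faces of Dom(G) are exactly the sets containing no closed neighbourhood N[w].
-- In any complex, a dominates b iff adding b to a face of the link (Δ : a) gives a face
-- of the deletion (Δ , a): the cone over the link with apex b is then the required C.
-- For Dom(G) this reads: whenever m ∪ {a} contains no N[w], neither does m ∪ {b}.
-- If N[w] ⊆ m ∪ {b} with b ∈ N[w] ∌ a, the condition supplies N[m'] ∖ {a} ⊆ N[w] ∖ {b} ⊆ m,
-- so N[m'] ⊆ m ∪ {a}. Conversely, for v ∈ N[b] ∖ N[a] apply the transfer to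
-- m = N[v] ∖ {b}: as N[v] ⊆ m ∪ {b}, the set m ∪ {a} must contain some N[m'].
module Submission where

open import Defs
open import Level using (0ℓ)
open import Data.Nat using (ℕ)
open import Data.Fin using (Fin; _≟_)
open import Data.Fin.Properties using (any?; all?)
open import Data.Fin.Subset using (Subset; _∈_; _∉_; _⊆_; _∪_; ⁅_⁆)
open import Data.Fin.Subset.Properties
  using (_∈?_; p⊆p∪q; x∈p∪q⁺; x∈p∪q⁻; x∈⁅x⁆; x∈⁅y⁆⇒x≡y; x∈∁p⇒x∉p; x∉p⇒x∈∁p)
open import Data.Vec using (tabulate)
open import Data.Vec.Properties using (lookup∘tabulate; []=⇒lookup; lookup⇒[]=)
open import Data.Product using (∃; _×_; _,_; proj₁)
open import Data.Sum using (_⊎_; inj₁; inj₂)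
open import Function using (_∘_)
open import Function.Bundles using (_⇔_; mk⇔; Equivalence)
open import Relation.Nullary using (¬_; Dec; yes; no; does; ¬?; contradiction)
open import Relation.Nullary.Decidable
  using (_×-dec_; _⊎-dec_; _→-dec_; dec-true; decidable-stable)
open import Relation.Unary using (Pred; Decidable)
open import Relation.Binary.PropositionalEquality using (_≢_; refl; sym; trans)

private
  variable
    n : ℕ

module _ {P : Pred (Fin n) 0ℓ} (P? : Decidable P) where

  toSubset : Subset n
  toSubset = tabulate (does ∘ P?)

  toSubset⁺ : ∀ {x} → P x → x ∈ toSubset
  toSubset⁺ {x} px = lookup⇒[]= x toSubset (trans (lookup∘tabulate _ x) (dec-true (P? x) px))

  toSubset⁻ : ∀ {x} → x ∈ toSubset → P x
  toSubset⁻ {x} x∈ with P? x | trans (sym (lookup∘tabulate (does ∘ P?) x)) ([]=⇒lookup x∈)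
  ... | yes px | _ = px
  ... | no _   | ()

x∈p∪⁅y⁆∧x≢y⇒x∈p : ∀ {p : Subset n} {x y} → x ∈ p ∪ ⁅ y ⁆ → x ≢ y → x ∈ p
x∈p∪⁅y⁆∧x≢y⇒x∈p {p = p} {y = y} x∈ x≢y with x∈p∪q⁻ p ⁅ y ⁆ x∈
... | inj₁ x∈p = x∈p
... | inj₂ x∈y = contradiction (x∈⁅y⁆⇒x≡y y x∈y) x≢y

x∉p∧x≢y⇒x∉p∪⁅y⁆ : ∀ {p : Subset n} {x y} → x ∉ p → x ≢ y → x ∉ p ∪ ⁅ y ⁆
x∉p∧x≢y⇒x∉p∪⁅y⁆ x∉p x≢y x∈ = x∉p (x∈p∪⁅y⁆∧x≢y⇒x∈p x∈ x≢y)

x≢y→x∈p⇒x∈p∪⁅y⁆ : ∀ {p : Subset n} {x y} → (x ≢ y → x ∈ p) → x ∈ p ∪ ⁅ y ⁆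
x≢y→x∈p⇒x∈p∪⁅y⁆ {x = x} {y} x≢y→x∈p with x ≟ y
... | yes refl = x∈p∪q⁺ (inj₂ (x∈⁅x⁆ x))
... | no x≢y   = x∈p∪q⁺ (inj₁ (x≢y→x∈p x≢y))

coneOver : SetFamily n → Fin n → SetFamily n
coneOver Δ b σ = ∃ λ m → Δ m × σ ⊆ m ∪ ⁅ b ⁆

module _ {Δ : SetFamily n} {b : Fin n} where

  coneOver-isComplex : IsComplex (coneOver Δ b)
  coneOver-isComplex σ τ τ⊆σ (m , Δm , σ⊆) = m , Δm , σ⊆ ∘ τ⊆σ

  coneOver-isCone : IsConeWithApex (coneOver Δ b) b
  coneOver-isCone σ (m , Δm , σ⊆) = m , Δm , λ {x} x∈ → σ∪⁅b⁆⊆ (x∈p∪q⁻ σ ⁅ b ⁆ x∈)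
    where
    σ∪⁅b⁆⊆ : ∀ {x} → x ∈ σ ⊎ x ∈ ⁅ b ⁆ → x ∈ m ∪ ⁅ b ⁆
    σ∪⁅b⁆⊆ (inj₁ x∈σ) = σ⊆ x∈σ
    σ∪⁅b⁆⊆ (inj₂ x∈b) = x∈p∪q⁺ (inj₂ x∈b)

  ⊆coneOver : ∀ m → Δ m → coneOver Δ b m
  ⊆coneOver m Δm = m , Δm , p⊆p∪q ⁅ b ⁆

deletion-isComplex : {Δ : SetFamily n} → IsComplex Δ → ∀ a → IsComplex (Deletion Δ a)
deletion-isComplex Δ-complex a σ τ τ⊆σ (Δσ , a∉σ) = Δ-complex σ τ τ⊆σ Δσ , a∉σ ∘ τ⊆σ

dominatesIn⇔ : {Δ : SetFamily n} → IsComplex Δ → ∀ a b →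
  DominatesIn Δ a b ⇔ (∀ m → Link Δ a m → Deletion Δ a (m ∪ ⁅ b ⁆))
dominatesIn⇔ {Δ = Δ} Δ-complex a b = mk⇔ to from
  where
  to : DominatesIn Δ a b → ∀ m → Link Δ a m → Deletion Δ a (m ∪ ⁅ b ⁆)
  to (C , _ , C-cone , link⊆C , C⊆deletion) m link =
    C⊆deletion (m ∪ ⁅ b ⁆) (C-cone m (link⊆C m link))

  from : (∀ m → Link Δ a m → Deletion Δ a (m ∪ ⁅ b ⁆)) → DominatesIn Δ a b
  from transfer = coneOver (Link Δ a) b , coneOver-isComplex , coneOver-isCone , ⊆coneOver ,
    λ σ (m , link , σ⊆) → deletion-isComplex Δ-complex a (m ∪ ⁅ b ⁆) σ σ⊆ (transfer m link)

module _ (G : Graph n) where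

  InN-sym : ∀ {u v} → InN G u v → InN G v u
  InN-sym (inj₁ refl) = inj₁ refl
  InN-sym (inj₂ uv)   = inj₂ (Adj-sym G uv)

  InN? : ∀ u v → Dec (InN G u v)
  InN? u v = (u ≟ v) ⊎-dec Adj-dec G u v

  N[_]⊆_ : Fin n → Subset n → Set
  N[ w ]⊆ σ = ∀ u → InN G u w → u ∈ σ

  N[_]⊆?_ : ∀ w σ → Dec (N[ w ]⊆ σ)
  N[ w ]⊆? σ = all? (λ u → InN? u w →-dec u ∈? σ)

  Dom⇔noClosedNbhd⊆ : ∀ σ → Dom G σ ⇔ (∀ w → ¬ N[ w ]⊆ σ)
  Dom⇔noClosedNbhd⊆ σ = mk⇔ to from
    where
    to : Dom G σ → ∀ w → ¬ N[ w ]⊆ σ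
    to dom w N[w]⊆σ with dom w
    ... | d , d∈∁σ , w∈N[d] = x∈∁p⇒x∉p d∈∁σ (N[w]⊆σ d (InN-sym w∈N[d]))

    from : (∀ w → ¬ N[ w ]⊆ σ) → Dom G σ
    from noN⊆ u with any? (λ d → InN? d u ×-dec ¬? (d ∈? σ))
    ... | yes (d , d∈N[u] , d∉σ) = d , x∉p⇒x∈∁p d∉σ , InN-sym d∈N[u]
    ... | no ∄d = contradiction (λ d d∈N[u] → decidable-stable (d ∈? σ) λ d∉σ → ∄d (d , d∈N[u] , d∉σ))
                                (noN⊆ u)

  Dom-isComplex : IsComplex (Dom G)
  Dom-isComplex σ τ τ⊆σ dom u with dom u
  ... | d , d∈∁σ , u∈N[d] = d , x∉p⇒x∈∁p (x∈∁p⇒x∉p d∈∁σ ∘ τ⊆σ) , u∈N[d]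

  N[_]∖⁅_⁆ : Fin n → Fin n → Subset n
  N[ v ]∖⁅ b ⁆ = toSubset (λ u → InN? u v ×-dec ¬? (u ≟ b))

  ∈N[]∖⁅⁆⁺ : ∀ {u v b} → InN G u v → u ≢ b → u ∈ N[ v ]∖⁅ b ⁆
  ∈N[]∖⁅⁆⁺ {v = v} {b} u∈N[v] u≢b = toSubset⁺ (λ u → InN? u v ×-dec ¬? (u ≟ b)) (u∈N[v] , u≢b)

  ∈N[]∖⁅⁆⁻ : ∀ {u v b} → u ∈ N[ v ]∖⁅ b ⁆ → InN G u v × u ≢ b
  ∈N[]∖⁅⁆⁻ {v = v} {b} = toSubset⁻ (λ u → InN? u v ×-dec ¬? (u ≟ b))

  N[_]∖⁅_⁆⊆N[_]∖⁅_⁆ : Fin n → Fin n → Fin n → Fin n → Set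
  N[ m ]∖⁅ a ⁆⊆N[ v ]∖⁅ b ⁆ = ∀ u → InN G u m → u ≢ a → InN G u v × u ≢ b

  DominationCondition : Fin n → Fin n → Set
  DominationCondition a b = ∀ v → InN G v b → ¬ InN G v a → ∃ λ m → N[ m ]∖⁅ a ⁆⊆N[ v ]∖⁅ b ⁆

  FaceTransfer : Fin n → Fin n → Set
  FaceTransfer a b = ∀ m → Link (Dom G) a m → Deletion (Dom G) a (m ∪ ⁅ b ⁆)

  module _ {a b : Fin n} (a≢b : a ≢ b) where

    closedNbhd⊆-shift : DominationCondition a b → ∀ {m w} → a ∉ m →
      N[ w ]⊆ (m ∪ ⁅ b ⁆) → ∃ λ w′ → N[ w′ ]⊆ (m ∪ ⁅ a ⁆)
    closedNbhd⊆-shift condition {m} {w} a∉m N[w]⊆ with InN? w a | InN? w b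
    ... | yes w∈N[a] | _ =
      contradiction (N[w]⊆ a (InN-sym w∈N[a])) (x∉p∧x≢y⇒x∉p∪⁅y⁆ a∉m a≢b)
    ... | no w∉N[a] | yes w∈N[b] =
      let m′ , N[m′]-a⊆N[w]-b = condition w w∈N[b] w∉N[a]
      in m′ , λ u u∈N[m′] → x≢y→x∈p⇒x∈p∪⁅y⁆ λ u≢a →
           let u∈N[w] , u≢b = N[m′]-a⊆N[w]-b u u∈N[m′] u≢a
           in x∈p∪⁅y⁆∧x≢y⇒x∈p (N[w]⊆ u u∈N[w]) u≢b
    ... | no _ | no w∉N[b] =
      w , λ u u∈N[w] → p⊆p∪q ⁅ a ⁆
            (x∈p∪⁅y⁆∧x≢y⇒x∈p (N[w]⊆ u u∈N[w]) λ { refl → w∉N[b] (InN-sym u∈N[w]) })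

    condition⇒faceTransfer : DominationCondition a b → FaceTransfer a b
    condition⇒faceTransfer condition m (_ , a∉m , dom[m∪a]) =
      Equivalence.from (Dom⇔noClosedNbhd⊆ (m ∪ ⁅ b ⁆)) noN⊆m∪b , x∉p∧x≢y⇒x∉p∪⁅y⁆ a∉m a≢b
      where
      noN⊆m∪b : ∀ w → ¬ N[ w ]⊆ (m ∪ ⁅ b ⁆)
      noN⊆m∪b w N[w]⊆ =
        let w′ , N[w′]⊆ = closedNbhd⊆-shift condition a∉m N[w]⊆
        in Equivalence.to (Dom⇔noClosedNbhd⊆ (m ∪ ⁅ a ⁆)) dom[m∪a] w′ N[w′]⊆

  faceTransfer⇒condition : ∀ {a b} → FaceTransfer a b → DominationCondition a b
  faceTransfer⇒condition {a} {b} transfer v _ v∉N[a]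
    with any? (λ w → N[ w ]⊆? (N[ v ]∖⁅ b ⁆ ∪ ⁅ a ⁆))
  ... | yes (w , N[w]⊆) = w , λ u u∈N[w] u≢a → ∈N[]∖⁅⁆⁻ (x∈p∪⁅y⁆∧x≢y⇒x∈p (N[w]⊆ u u∈N[w]) u≢a)
  ... | no ∄w = contradiction N[v]⊆S∪b (Equivalence.to (Dom⇔noClosedNbhd⊆ (S ∪ ⁅ b ⁆)) dom[S∪b] v)
    where
    S = N[ v ]∖⁅ b ⁆
    dom[S∪a] : Dom G (S ∪ ⁅ a ⁆)
    dom[S∪a] = Equivalence.from (Dom⇔noClosedNbhd⊆ (S ∪ ⁅ a ⁆)) λ w N[w]⊆ → ∄w (w , N[w]⊆)
    a∉S : a ∉ S
    a∉S a∈S = v∉N[a] (InN-sym (proj₁ (∈N[]∖⁅⁆⁻ a∈S)))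
    dom[S∪b] : Dom G (S ∪ ⁅ b ⁆)
    dom[S∪b] = proj₁ (transfer S (Dom-isComplex _ S (p⊆p∪q ⁅ a ⁆) dom[S∪a] , a∉S , dom[S∪a]))
    N[v]⊆S∪b : N[ v ]⊆ (S ∪ ⁅ b ⁆)
    N[v]⊆S∪b u u∈N[v] = x≢y→x∈p⇒x∈p∪⁅y⁆ λ u≢b → ∈N[]∖⁅⁆⁺ u∈N[v] u≢b

mainTheorem7 : {n : ℕ} (G : Graph n) (a b : Fin n) →
    a ≢ b → (∃ λ u → Adj G a u) → (∃ λ u → Adj G b u) →
    DominatesIn (Dom G) a b
      ⇔ (∀ v → InN G v b → ¬ InN G v a →
           ∃ λ m → ∀ u → InN G u m → u ≢ a → InN G u v × u ≢ b)
mainTheorem7 G a b a≢b _ _ =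
  mk⇔ (faceTransfer⇒condition G ∘ Equivalence.to dominates⇔transfer)
      (Equivalence.from dominates⇔transfer ∘ condition⇒faceTransfer G a≢b)
  where
  dominates⇔transfer = dominatesIn⇔ (Dom-isComplex G) a b
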